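{- Let $n\ge 2$, let $r$ be a positive integer and let $0<c\le 1/n^n$. Let $H=(V,E)$ be an $n$-uniform hypergraph with at most $c r^n$ edges. Then $H$ contains an independent set $I\subseteq V$ such that the hypergraph $H\setminus I$ has at most $c(r-1)^n$ edges.
   Context: A hypergraph $H=(V,E)$ consists of a finite vertex set $V$ and a family $E$ of subsets of $V$ (edges); it is $n$-uniform if every edge has exactly $n$ elements. A set $I\subseteq V$ is independent if it contains no edge of $H$. $H\setminus I$ denotes the hypergraph on $V\setminus I$ whose edges are the edges of $H$ disjoint from $I$.
   Formalization: The constant c with $0<c\le 1/n^n$ is taken in the rationals. -}

module Defs where

open import Data.Nat using (ℕ; zero; suc; _^_)
open import Data.Nat.Properties using (m^n≢0)
open import Data.Integer using (+_)
open import Data.Rational using (ℚ; _/_)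
open import Data.Bool.Properties using () renaming (_≟_ to _≟ᵇ_)
open import Data.Vec.Properties using (≡-dec)
open import Data.Fin.Subset using (Subset; ∣_∣; _⊆_; _∩_; ⊥)
open import Data.List using (List; length; filter)
open import Data.List.Relation.Unary.All using (All)
open import Data.List.Relation.Unary.Unique.Propositional using (Unique)
open import Relation.Nullary using (¬_)
open import Relation.Binary.PropositionalEquality using (_≡_)

-- A hypergraph on the vertex set Fin nV: a duplicate-free list of edges
-- (so E is a genuine set of subsets of V).
record Hypergraph (nV : ℕ) : Set where
  field
    edges    : List (Subset nV)
    distinct : Unique edges
open Hypergraph public

numEdges : ∀ {nV} → Hypergraph nV → ℕ
numEdges H = length (edges H)

Uniform : ∀ {nV} → ℕ → Hypergraph nV → Set
Uniform n H = All (λ e → ∣ e ∣ ≡ n) (edges H)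

Independent : ∀ {nV} → Hypergraph nV → Subset nV → Set
Independent H I = All (λ e → ¬ (e ⊆ I)) (edges H)

-- edges of H disjoint from I, i.e. the edges of H \ I
-- (H \ I lives on V \ I; we only need its edge set / edge count)
edgesAvoiding : ∀ {nV} → Hypergraph nV → Subset nV → List (Subset nV)
edgesAvoiding H I = filter (λ e → ≡-dec _≟ᵇ_ (e ∩ I) ⊥) (edges H)

numEdgesMinus : ∀ {nV} → Hypergraph nV → Subset nV → ℕ
numEdgesMinus H I = length (edgesAvoiding H I)

ℕtoℚ : ℕ → ℚ
ℕtoℚ m = + m / 1

-- the rational 1 / n^n  (for n = 0 this is 1/0^0 = 1; only n ≥ 2 is used)
inv-nⁿ : ℕ → ℚ
inv-nⁿ zero    = + 1 / 1
inv-nⁿ (suc k) = _/_ (+ 1) (suc k ^ suc k) {{m^n≢0 (suc k) (suc k)}}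

module Submission where

-- For r = 1 the hypotheses force H to have no edges and
-- I = ∅ works.  For r = s+2 let Δ = K+1 be the maximum degree, attained at u.
-- If the star I = {u} leaves few enough edges we are done.  Otherwise the
-- failure of the star shows that K·2^n ≤ (s+1)^n - s^n, and we use the
-- alteration method: take a random set A containing each vertex with
-- probability 2/(s+2) and delete one vertex from each edge inside A.  The
-- potential  #(edges missing A) + K·#(edges inside A)  does not increase under
-- a deletion, since every degree is at most K+1, and its expectation is
--   |E|·(s^n + K·2^n)/(s+2)^n ≤ |E|·((s+1)/(s+2))^n.
-- Expectations are computed exactly as weighted sums over all subsets.

open import Defs

module Arithmetic where

  open import Data.Nat
  open import Data.Nat.Properties
  open import Data.Nat.Tactic.RingSolver using (solve-∀)
  open import Data.Fin using (Fin; zero; suc)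
  open import Data.Product using (Σ; ∃; _×_; _,_)
  open import Data.Sum using (_⊎_; inj₁; inj₂)
  open import Relation.Nullary using (yes; no; contradiction)
  open import Relation.Binary.PropositionalEquality

  ^-distrib-* : ∀ m n k → (m * n) ^ k ≡ m ^ k * n ^ k
  ^-distrib-* m n zero    = refl
  ^-distrib-* m n (suc k) = trans (cong (m * n *_) (^-distrib-* m n k)) (interchange m n (m ^ k) (n ^ k))
    where
    interchange : ∀ a b c d → a * b * (c * d) ≡ a * c * (b * d)
    interchange = solve-∀

  pow-suc-lower : ∀ a k → a ^ suc k + suc k * a ^ k ≤ suc a ^ suc k
  pow-suc-lower a zero = ≤-reflexive (eq a)
    where
    eq : ∀ a → a * 1 + 1 * 1 ≡ (1 + a) * 1
    eq = solve-∀
  pow-suc-lower a (suc k) = begin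
    a * (a * a ^ k) + (2 + k) * (a * a ^ k)
      ≤⟨ m≤m+n _ _ ⟩
    a * (a * a ^ k) + (2 + k) * (a * a ^ k) + (1 + k) * a ^ k
      ≡⟨ eq a (a ^ k) k ⟩
    (1 + a) * (a * a ^ k + (1 + k) * a ^ k)
      ≤⟨ *-monoʳ-≤ (suc a) (pow-suc-lower a k) ⟩
    suc a * suc a ^ suc k ∎
    where
    open ≤-Reasoning
    eq : ∀ a p k → a * (a * p) + (2 + k) * (a * p) + (1 + k) * p ≡ (1 + a) * (a * p + (1 + k) * p)
    eq = solve-∀

  pow-suc-upper : ∀ a k → suc a ^ suc k ≤ a ^ suc k + suc k * suc a ^ k
  pow-suc-upper a zero = ≤-reflexive (eq a)
    where
    eq : ∀ a → (1 + a) * 1 ≡ a * 1 + 1 * 1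
    eq = solve-∀
  pow-suc-upper a (suc k) = begin
    (1 + a) * suc a ^ suc k
      ≤⟨ *-monoʳ-≤ (suc a) (pow-suc-upper a k) ⟩
    (1 + a) * (a ^ suc k + (1 + k) * suc a ^ k)
      ≡⟨ eq₁ a (a ^ suc k) (suc a ^ k) k ⟩
    a * a ^ suc k + a ^ suc k + (1 + k) * ((1 + a) * suc a ^ k)
      ≤⟨ +-monoˡ-≤ _ (+-monoʳ-≤ (a * a ^ suc k) (^-monoˡ-≤ (suc k) (n≤1+n a))) ⟩
    a * a ^ suc k + suc a ^ suc k + (1 + k) * ((1 + a) * suc a ^ k)
      ≡⟨ eq₂ (a * a ^ suc k) ((1 + a) * suc a ^ k) k ⟩
    a * a ^ suc k + (2 + k) * ((1 + a) * suc a ^ k) ∎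
    where
    open ≤-Reasoning
    eq₁ : ∀ a p q k → (1 + a) * (p + (1 + k) * q) ≡ a * p + p + (1 + k) * ((1 + a) * q)
    eq₁ = solve-∀
    eq₂ : ∀ x w k → x + w + (1 + k) * w ≡ x + (2 + k) * w
    eq₂ = solve-∀

  -- The analytic heart of the proof: for n = k+1 ≥ 2 and every s,
  --   2^n · n · (2+s)^k  ≤  n^n · n · s^k + n^n · 2^n,
  -- i.e. (2/n)^n · n(2+s)^(n-1) ≤ n·s^(n-1) + 2^n.  It compares the slope of
  -- x^n just above s+1, scaled by (2/n)^n, with the slope just below it.
  Gap : ℕ → ℕ → Set
  Gap k s = 2 ^ suc k * suc k * (2 + s) ^ k ≤ suc k ^ suc k * suc k * s ^ k + suc k ^ suc k * 2 ^ suc k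

  -- When 2 + s ≤ n the second summand alone dominates.
  gap-small : ∀ k s → 2 + s ≤ suc k → Gap k s
  gap-small k s 2+s≤n = begin
    2 ^ suc k * suc k * (2 + s) ^ k  ≤⟨ *-monoʳ-≤ (2 ^ suc k * suc k) (^-monoˡ-≤ k 2+s≤n) ⟩
    2 ^ suc k * suc k * suc k ^ k    ≡⟨ eq (2 ^ suc k) (suc k) (suc k ^ k) ⟩
    suc k ^ suc k * 2 ^ suc k        ≤⟨ m≤n+m _ _ ⟩
    suc k ^ suc k * suc k * s ^ k + suc k ^ suc k * 2 ^ suc k ∎
    where
    open ≤-Reasoning
    eq : ∀ t n p → t * n * p ≡ (n * p) * t
    eq = solve-∀

  -- When 2(2 + s) ≤ n·s the first summand alone dominates.
  gap-large : ∀ k s → 2 ≤ suc k → 2 * (2 + s) ≤ suc k * s → Gap k s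
  gap-large k s 2≤n 2[2+s]≤ns = begin
    2 * 2 ^ k * suc k * (2 + s) ^ k  ≡⟨ eq₁ (2 ^ k) (suc k) ((2 + s) ^ k) ⟩
    suc k * (2 * (2 ^ k * (2 + s) ^ k)) ≡⟨ cong (λ z → suc k * (2 * z)) (sym (^-distrib-* 2 (2 + s) k)) ⟩
    suc k * (2 * (2 * (2 + s)) ^ k)  ≤⟨ *-monoʳ-≤ (suc k) (*-mono-≤ 2≤n (^-monoˡ-≤ k 2[2+s]≤ns)) ⟩
    suc k * (suc k * (suc k * s) ^ k) ≡⟨ cong (λ z → suc k * (suc k * z)) (^-distrib-* (suc k) s k) ⟩
    suc k * (suc k * (suc k ^ k * s ^ k)) ≡⟨ eq₂ (suc k) (suc k ^ k) (s ^ k) ⟩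
    suc k ^ suc k * suc k * s ^ k    ≤⟨ m≤m+n _ _ ⟩
    suc k ^ suc k * suc k * s ^ k + suc k ^ suc k * 2 ^ suc k ∎
    where
    open ≤-Reasoning
    eq₁ : ∀ b n p → 2 * b * n * p ≡ n * (2 * (b * p))
    eq₁ = solve-∀
    eq₂ : ∀ n q p → n * (n * (q * p)) ≡ n * q * n * p
    eq₂ = solve-∀

  -- Gap k s for all n = k+1 ≥ 2 and all s: below n the small-s bound applies;
  -- beyond it the large-s bound, except for n = 2 (an identity) and the two
  -- values s = 2, 3 when n = 3, which are checked numerically.
  gap : ∀ k s → 1 ≤ k → Gap k s
  gap (suc zero) s _ = ≤-reflexive (identity s)
    where
    identity : ∀ s → 2 * (2 * 1) * 2 * ((2 + s) * 1) ≡ 2 * (2 * 1) * 2 * (s * 1) + 2 * (2 * 1) * (2 * (2 * 1))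
    identity = solve-∀
  gap (suc (suc k)) s _ with 2 + s ≤? suc (suc (suc k))
  ... | yes small = gap-small (suc (suc k)) s small
  ... | no  n<2+s = gap-beyond k s (≰⇒> n<2+s)
    where
    gap-beyond : ∀ k s → 3 + k < 2 + s → Gap (2 + k) s
    gap-beyond zero 0 (s≤s (s≤s ()))
    gap-beyond zero 1 (s≤s (s≤s (s≤s ())))
    gap-beyond zero 2 _ = m≤m+n 384 156
    gap-beyond zero 3 _ = m≤m+n 600 345
    gap-beyond zero (suc (suc (suc (suc s)))) _ = gap-large 2 (4 + s) (s≤s (s≤s z≤n)) (slack s)
      where
      slack : ∀ s → 2 * (2 + (4 + s)) ≤ 3 * (4 + s)
      slack s = subst (2 * (2 + (4 + s)) ≤_) (eq s) (m≤m+n _ s)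
        where
        eq : ∀ s → 2 * (2 + (4 + s)) + s ≡ 3 * (4 + s)
        eq = solve-∀
    gap-beyond (suc k) s n<2+s = gap-large (3 + k) s (s≤s (s≤s z≤n)) (begin
      2 * (2 + s)          ≡⟨ eq₁ s ⟩
      2 * s + 4            ≤⟨ +-monoʳ-≤ (2 * s) (*-monoʳ-≤ 2 2≤s) ⟩
      2 * s + 2 * s        ≤⟨ +-monoʳ-≤ (2 * s) (*-monoˡ-≤ s (s≤s (s≤s (z≤n {k})))) ⟩
      2 * s + (2 + k) * s  ≡⟨ eq₂ s k ⟩
      (4 + k) * s ∎)
      where
      open ≤-Reasoning
      2≤s : 2 ≤ s
      2≤s = ≤-trans (s≤s (s≤s z≤n)) (+-cancelˡ-≤ 2 3 s (≤-trans (s≤s (s≤s (s≤s (s≤s (s≤s (z≤n {k})))))) n<2+s))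
      eq₁ : ∀ s → 2 * (2 + s) ≡ 2 * s + 4
      eq₁ = solve-∀
      eq₂ : ∀ s k → 2 * s + (2 + k) * s ≡ (4 + k) * s
      eq₂ = solve-∀

  -- By the upper bound on (s+2)^n the hypothesis gives (K+1)·n^n ≤ n(s+2)^k;
  -- by 'gap' this forces K·2^n ≤ n·s^k, and the lower bound on (s+1)^n concludes.
  increment-transfer : ∀ n s K → 2 ≤ n →
    suc K * n ^ n + suc s ^ n ≤ (2 + s) ^ n →
    s ^ n + K * 2 ^ n ≤ suc s ^ n
  increment-transfer (suc k) s K (s≤s 1≤k) hyp = begin
    S + K * T  ≤⟨ +-monoʳ-≤ S K*T≤n*U ⟩
    S + n * U  ≤⟨ pow-suc-lower s k ⟩
    P ∎
    where
    open ≤-Reasoning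
    n = suc k
    N = n ^ n
    T = 2 ^ n
    S = s ^ n
    P = suc s ^ n
    U = s ^ k
    V = (2 + s) ^ k
    instance
      N≢0 : NonZero N
      N≢0 = m^n≢0 n n
    K+1·N≤n·V : suc K * N ≤ n * V
    K+1·N≤n·V = +-cancelʳ-≤ P (suc K * N) (n * V) (begin
      suc K * N + P      ≤⟨ hyp ⟩
      (2 + s) ^ n        ≤⟨ pow-suc-upper (suc s) k ⟩
      P + n * V          ≡⟨ +-comm P (n * V) ⟩
      n * V + P ∎)
    K*T≤n*U : K * T ≤ n * U
    K*T≤n*U = *-cancelˡ-≤ N (+-cancelʳ-≤ (N * T) (N * (K * T)) (N * (n * U)) (begin
      N * (K * T) + N * T  ≡⟨ eq₁ N K T ⟩
      T * (suc K * N)      ≤⟨ *-monoʳ-≤ T K+1·N≤n·V ⟩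
      T * (n * V)          ≡⟨ sym (*-assoc T n V) ⟩
      T * n * V            ≤⟨ gap k s 1≤k ⟩
      N * n * U + N * T    ≡⟨ cong (_+ N * T) (*-assoc N n U) ⟩
      N * (n * U) + N * T ∎))
      where
      eq₁ : ∀ N K T → N * (K * T) + N * T ≡ T * ((1 + K) * N)
      eq₁ = solve-∀

  ratio-transfer : ∀ x m a b Q R P .{{_ : NonZero R}} →
    x * R ≤ m * Q → m * b ≤ a * R → Q ≤ P → x * b ≤ a * P
  ratio-transfer x m a b Q R P xR≤mQ mb≤aR Q≤P = *-cancelˡ-≤ R (begin
    R * (x * b)    ≡⟨ eq₁ R x b ⟩
    b * (x * R)    ≤⟨ *-monoʳ-≤ b xR≤mQ ⟩
    b * (m * Q)    ≡⟨ eq₂ b m Q ⟩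
    (m * b) * Q    ≤⟨ *-mono-≤ mb≤aR Q≤P ⟩
    (a * R) * P    ≡⟨ eq₃ a R P ⟩
    R * (a * P) ∎)
    where
    open ≤-Reasoning
    eq₁ : ∀ R x b → R * (x * b) ≡ b * (x * R)
    eq₁ = solve-∀
    eq₂ : ∀ b m Q → b * (m * Q) ≡ (m * b) * Q
    eq₂ = solve-∀
    eq₃ : ∀ a R P → (a * R) * P ≡ R * (a * P)
    eq₃ = solve-∀

  vanishing : ∀ m a b M .{{_ : NonZero b}} → 2 ≤ M → m * b ≤ a → a * M ≤ b → m ≡ 0
  vanishing zero    a b M _   _     _     = refl
  vanishing (suc m) a b M 2≤M mb≤a aM≤b = contradiction (*-cancelˡ-≤ b (begin
    b * 2          ≤⟨ *-monoʳ-≤ b 2≤M ⟩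
    b * M          ≤⟨ *-monoˡ-≤ M (≤-trans (m≤m+n b (m * b)) mb≤a) ⟩
    a * M          ≤⟨ aM≤b ⟩
    b              ≡⟨ *-identityʳ b ⟨
    b * 1 ∎)) (λ { (s≤s ()) })
    where open ≤-Reasoning

  bounded-attained : ∀ {N} (f : Fin N → ℕ) →
    Σ ℕ λ M → (∀ i → f i ≤ M) × (M ≡ 0 ⊎ ∃ λ i → f i ≡ M)
  bounded-attained {zero}  f = 0 , (λ ()) , inj₁ refl
  bounded-attained {suc N} f with bounded-attained (λ i → f (suc i))
  ... | M , f≤M , M-attained with f zero ≤? M
  ...   | yes f0≤M = M , bound , suc-attained M-attained
    where
    bound : ∀ i → f i ≤ M
    bound zero    = f0≤M
    bound (suc i) = f≤M i
    suc-attained : M ≡ 0 ⊎ ∃ (λ i → f (suc i) ≡ M) → M ≡ 0 ⊎ ∃ (λ i → f i ≡ M)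
    suc-attained (inj₁ M≡0)       = inj₁ M≡0
    suc-attained (inj₂ (i , fi≡M)) = inj₂ (suc i , fi≡M)
  ...   | no  f0≰M = f zero , bound , inj₂ (zero , refl)
    where
    bound : ∀ i → f i ≤ f zero
    bound zero    = ≤-refl
    bound (suc i) = ≤-trans (f≤M i) (<⇒≤ (≰⇒> f0≰M))

module Subsets where

  open import Data.Nat
  open import Data.Nat.Properties
  open import Data.Nat.Tactic.RingSolver using (solve-∀)
  open import Data.Bool using (Bool; true; false; _∧_; not)
  open import Data.Bool.Properties using (∧-zeroʳ) renaming (_≟_ to _≟ᵇ_)
  open import Data.Fin using (Fin; zero; suc)
  open import Data.Fin.Properties using () renaming (suc-injective to fsuc-injective)
  open import Data.Vec using ([]; _∷_; lookup; _[_]≔_; here)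
  open import Data.Vec.Properties using (≡-dec)
  open import Data.Fin.Subset using (Subset; ∣_∣; _⊆_; _∩_; ⊥; ⁅_⁆)
  open import Data.Fin.Subset.Properties using (drop-∷-⊆)
  open import Data.List using (List; []; _∷_; length)
  open import Data.List.Membership.Propositional using (_∈_)
  open import Data.List.Relation.Unary.Any using (here; there)
  open import Data.List.Relation.Unary.All using (All; []; _∷_)
  open import Data.Product using (Σ; ∃; _×_; _,_)
  open import Data.Sum using (_⊎_; inj₁; inj₂)
  open import Relation.Nullary using (does; yes)
  open import Relation.Binary.PropositionalEquality

  sumOver : {A : Set} → List A → (A → ℕ) → ℕ
  sumOver []       g = 0
  sumOver (x ∷ xs) g = g x + sumOver xs g

  module _ {A : Set} where

    sumOver-+ : ∀ (xs : List A) g h → sumOver xs (λ x → g x + h x) ≡ sumOver xs g + sumOver xs h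
    sumOver-+ []       g h = refl
    sumOver-+ (x ∷ xs) g h = trans (cong (g x + h x +_) (sumOver-+ xs g h))
                                   (interchange (g x) (h x) (sumOver xs g) (sumOver xs h))
      where
      interchange : ∀ a b c d → a + b + (c + d) ≡ a + c + (b + d)
      interchange = solve-∀

    sumOver-*ʳ : ∀ (xs : List A) g k → sumOver xs (λ x → g x * k) ≡ sumOver xs g * k
    sumOver-*ʳ []       g k = refl
    sumOver-*ʳ (x ∷ xs) g k = trans (cong (g x * k +_) (sumOver-*ʳ xs g k)) (sym (*-distribʳ-+ k (g x) (sumOver xs g)))

    sumOver-const : ∀ (xs : List A) c → sumOver xs (λ _ → c) ≡ length xs * c
    sumOver-const []       c = refl
    sumOver-const (x ∷ xs) c = cong (c +_) (sumOver-const xs c)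

    sumOver-mono : ∀ (xs : List A) {g h} → (∀ x → g x ≤ h x) → sumOver xs g ≤ sumOver xs h
    sumOver-mono []       g≤h = z≤n
    sumOver-mono (x ∷ xs) g≤h = +-mono-≤ (g≤h x) (sumOver-mono xs g≤h)

    sumOver-cong : ∀ {xs : List A} {g h} → All (λ x → g x ≡ h x) xs → sumOver xs g ≡ sumOver xs h
    sumOver-cong []           = refl
    sumOver-cong (gx≡hx ∷ eqs) = cong₂ _+_ gx≡hx (sumOver-cong eqs)

    term≤sumOver : ∀ {xs : List A} {x} g → x ∈ xs → g x ≤ sumOver xs g
    term≤sumOver {y ∷ xs} g (here refl) = m≤m+n (g y) (sumOver xs g)
    term≤sumOver {y ∷ xs} g (there x∈xs) = ≤-trans (term≤sumOver g x∈xs) (m≤n+m (sumOver xs g) (g y))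

  𝟙 : Bool → ℕ
  𝟙 true  = 1
  𝟙 false = 0

  𝟙≤1 : ∀ b → 𝟙 b ≤ 1
  𝟙≤1 true  = ≤-refl
  𝟙≤1 false = z≤n

  -- agreesOn b e A: the subset A takes the value b on every element of e.
  -- For b = false this says that e misses A, for b = true that e ⊆ A; both
  -- events are treated uniformly below.
  agreesOn : ∀ {N} → Bool → Subset N → Subset N → Bool
  agreesOn b []          []      = true
  agreesOn b (false ∷ e) (_ ∷ A) = agreesOn b e A
  agreesOn b (true  ∷ e) (x ∷ A) = does (x ≟ᵇ b) ∧ agreesOn b e A

  disjoint?≡agreesOn : ∀ {N} (e A : Subset N) → does (≡-dec _≟ᵇ_ (e ∩ A) ⊥) ≡ agreesOn false e A
  disjoint?≡agreesOn []          []      = refl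
  disjoint?≡agreesOn (false ∷ e) (_ ∷ A) = disjoint?≡agreesOn e A
  disjoint?≡agreesOn (true  ∷ e) (x ∷ A) = cong (does (x ≟ᵇ false) ∧_) (disjoint?≡agreesOn e A)

  ⊆⇒agreesOn : ∀ {N} {e A : Subset N} → e ⊆ A → agreesOn true e A ≡ true
  ⊆⇒agreesOn {e = []}        {[]}        _   = refl
  ⊆⇒agreesOn {e = false ∷ e} {_ ∷ A}     e⊆A = ⊆⇒agreesOn (drop-∷-⊆ e⊆A)
  ⊆⇒agreesOn {e = true ∷ e}  {true ∷ A}  e⊆A = ⊆⇒agreesOn (drop-∷-⊆ e⊆A)
  ⊆⇒agreesOn {e = true ∷ e}  {false ∷ A} e⊆A with e⊆A here
  ... | ()

  agreesOn-update : ∀ {N} b (e A : Subset N) u y → lookup e u ≡ false →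
    agreesOn b e (A [ u ]≔ y) ≡ agreesOn b e A
  agreesOn-update b (false ∷ e) (_ ∷ A) zero    y _    = refl
  agreesOn-update b (false ∷ e) (_ ∷ A) (suc u) y eu≡f = agreesOn-update b e A u y eu≡f
  agreesOn-update b (true  ∷ e) (x ∷ A) (suc u) y eu≡f = cong (does (x ≟ᵇ b) ∧_) (agreesOn-update b e A u y eu≡f)

  agreesOn-conflict : ∀ {N} b (e A : Subset N) u → lookup e u ≡ true → lookup A u ≡ not b →
    agreesOn b e A ≡ false
  agreesOn-conflict false (true ∷ e) (true  ∷ A) zero    _ _ = refl
  agreesOn-conflict true  (true ∷ e) (false ∷ A) zero    _ _ = refl
  agreesOn-conflict b (false ∷ e) (_ ∷ A) (suc u) eu Au = agreesOn-conflict b e A u eu Au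
  agreesOn-conflict b (true  ∷ e) (x ∷ A) (suc u) eu Au
    rewrite agreesOn-conflict b e A u eu Au = ∧-zeroʳ (does (x ≟ᵇ b))

  agreesOn-lookup : ∀ {N} b (e A : Subset N) w → agreesOn b e A ≡ true → lookup e w ≡ true →
    lookup A w ≡ b
  agreesOn-lookup b (true  ∷ e) (x ∷ A) zero    agree _ with x ≟ᵇ b
  ... | yes x≡b = x≡b
  agreesOn-lookup b (false ∷ e) (_ ∷ A) (suc w) agree ew = agreesOn-lookup b e A w agree ew
  agreesOn-lookup b (true  ∷ e) (x ∷ A) (suc w) agree ew with x ≟ᵇ b
  ... | yes _ = agreesOn-lookup b e A w agree ew

  agreesOn-⊥ : ∀ {N} (e : Subset N) → agreesOn false e ⊥ ≡ true
  agreesOn-⊥ []          = refl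
  agreesOn-⊥ (false ∷ e) = agreesOn-⊥ e
  agreesOn-⊥ (true  ∷ e) = agreesOn-⊥ e

  agreesOn-⁅⁆ : ∀ {N} (e : Subset N) u → agreesOn false e ⁅ u ⁆ ≡ not (lookup e u)
  agreesOn-⁅⁆ (false ∷ e) zero    = agreesOn-⊥ e
  agreesOn-⁅⁆ (true  ∷ e) zero    = refl
  agreesOn-⁅⁆ (false ∷ e) (suc u) = agreesOn-⁅⁆ e u
  agreesOn-⁅⁆ (true  ∷ e) (suc u) = agreesOn-⁅⁆ e u

  ∣remove∣ : ∀ {N} (A : Subset N) u → lookup A u ≡ true → suc ∣ A [ u ]≔ false ∣ ≡ ∣ A ∣
  ∣remove∣ (true  ∷ A) zero    _  = refl
  ∣remove∣ (true  ∷ A) (suc u) Au = cong suc (∣remove∣ A u Au)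
  ∣remove∣ (false ∷ A) (suc u) Au = ∣remove∣ A u Au

  an-element : ∀ {N} (e : Subset N) → 1 ≤ ∣ e ∣ → Σ (Fin N) λ w → lookup e w ≡ true
  an-element (true  ∷ e) _ = zero , refl
  an-element (false ∷ e) 1≤∣e∣ with an-element e 1≤∣e∣
  ... | w , ew = suc w , ew

  two-elements : ∀ {N} (e : Subset N) → 2 ≤ ∣ e ∣ →
    Σ (Fin N) λ u → Σ (Fin N) λ w → u ≢ w × lookup e u ≡ true × lookup e w ≡ true
  two-elements (true  ∷ e) (s≤s 1≤∣e∣) with an-element e 1≤∣e∣
  ... | w , ew = zero , suc w , (λ ()) , refl , ew
  two-elements (false ∷ e) 2≤∣e∣ with two-elements e 2≤∣e∣
  ... | u , w , u≢w , eu , ew = suc u , suc w , (λ su≡sw → u≢w (fsuc-injective su≡sw)) , eu , ew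

  degree : ∀ {N} → List (Subset N) → Fin N → ℕ
  degree E u = sumOver E (λ f → 𝟙 (lookup f u))

  inside-edge? : ∀ {N} (E : List (Subset N)) A →
    (∃ λ e → e ∈ E × agreesOn true e A ≡ true) ⊎ All (λ e → agreesOn true e A ≡ false) E
  inside-edge? []      A = inj₂ []
  inside-edge? (e ∷ E) A with agreesOn true e A in e-inside
  ... | true  = inj₁ (e , here refl , e-inside)
  ... | false with inside-edge? E A
  ...   | inj₁ (f , f∈E , f-inside) = inj₁ (f , there f∈E , f-inside)
  ...   | inj₂ none-inside          = inj₂ (e-inside ∷ none-inside)

module AlterationMethod where

  open import Data.Nat
  open import Data.Nat.Properties
  open import Data.Nat.Tactic.RingSolver using (solve-∀)
  open import Data.Bool using (Bool; true; false; _∧_; not)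
  open import Data.Vec using ([]; _∷_; lookup; _[_]≔_)
  open import Data.Vec.Properties using (lookup∘updateAt; lookup∘updateAt′)
  open import Data.Fin.Subset using (Subset; ∣_∣)
  open import Data.List using (List; []; _∷_; length)
  open import Data.List.Membership.Propositional using (_∈_)
  open import Data.List.Relation.Unary.All using (All)
  import Data.List.Relation.Unary.All as All
  open import Data.Product using (∃; _×_; _,_)
  open import Data.Sum using (inj₁; inj₂)
  open import Relation.Nullary using (yes; no)
  open import Relation.Binary.PropositionalEquality

  open Subsets

  edgeCost : ∀ {N} → ℕ → Subset N → Subset N → ℕ
  edgeCost K A e = 𝟙 (agreesOn false e A) + K * 𝟙 (agreesOn true e A)

  potential : ∀ {N} → ℕ → List (Subset N) → Subset N → ℕ
  potential K E A = sumOver E (edgeCost K A)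

  missing : ∀ {N} → List (Subset N) → Subset N → ℕ
  missing E A = sumOver E (λ e → 𝟙 (agreesOn false e A))

  -- Weighted sums over all subsets of Fin N: a vertex inside A has weight t
  -- and one outside has weight s, so
  --   𝔼 N f = Σ_{A ⊆ Fin N} t^|A| · s^(N-|A|) · f(A),
  -- which is (t+s)^N times the expectation of f(A) for a random set A that
  -- contains each vertex independently with probability t/(t+s).
  module SubsetAverage (t s : ℕ) where

    weight : Bool → ℕ
    weight true  = t
    weight false = s

    𝔼 : ∀ N → (Subset N → ℕ) → ℕ
    𝔼 zero    f = f []
    𝔼 (suc N) f = t * 𝔼 N (λ A → f (true ∷ A)) + s * 𝔼 N (λ A → f (false ∷ A))

    𝔼-0 : ∀ N → 𝔼 N (λ _ → 0) ≡ 0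
    𝔼-0 zero    = refl
    𝔼-0 (suc N) rewrite 𝔼-0 N = cong₂ _+_ (*-zeroʳ t) (*-zeroʳ s)

    𝔼-+ : ∀ N f g → 𝔼 N (λ A → f A + g A) ≡ 𝔼 N f + 𝔼 N g
    𝔼-+ zero    f g = refl
    𝔼-+ (suc N) f g rewrite 𝔼-+ N (λ A → f (true ∷ A)) (λ A → g (true ∷ A))
                          | 𝔼-+ N (λ A → f (false ∷ A)) (λ A → g (false ∷ A)) = distrib t s _ _ _ _
      where
      distrib : ∀ t s a b c d → t * (a + b) + s * (c + d) ≡ t * a + s * c + (t * b + s * d)
      distrib = solve-∀

    𝔼-* : ∀ N k f → 𝔼 N (λ A → k * f A) ≡ k * 𝔼 N f
    𝔼-* zero    k f = refl
    𝔼-* (suc N) k f rewrite 𝔼-* N k (λ A → f (true ∷ A)) | 𝔼-* N k (λ A → f (false ∷ A)) = distrib t s k _ _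
      where
      distrib : ∀ t s k a c → t * (k * a) + s * (k * c) ≡ k * (t * a + s * c)
      distrib = solve-∀

    𝔼-sumOver : ∀ {B : Set} N (xs : List B) (g : B → Subset N → ℕ) →
      𝔼 N (λ A → sumOver xs (λ x → g x A)) ≡ sumOver xs (λ x → 𝔼 N (g x))
    𝔼-sumOver N []       g = 𝔼-0 N
    𝔼-sumOver N (x ∷ xs) g = trans (𝔼-+ N (g x) (λ A → sumOver xs (λ y → g y A))) (cong (𝔼 N (g x) +_) (𝔼-sumOver N xs g))

    below-halves : ∀ N f x → (t + s) ^ N * x ≤ 𝔼 N (λ A → f (true ∷ A)) → (t + s) ^ N * x ≤ 𝔼 N (λ A → f (false ∷ A)) →
      (t + s) ^ suc N * x ≤ 𝔼 (suc N) f
    below-halves N f x ≤𝔼₁ ≤𝔼₀ = begin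
      (t + s) * (t + s) ^ N * x                        ≡⟨ distrib t s ((t + s) ^ N) x ⟩
      t * ((t + s) ^ N * x) + s * ((t + s) ^ N * x)    ≤⟨ +-mono-≤ (*-monoʳ-≤ t ≤𝔼₁) (*-monoʳ-≤ s ≤𝔼₀) ⟩
      t * _ + s * _ ∎
      where
      open ≤-Reasoning
      distrib : ∀ t s R x → (t + s) * R * x ≡ t * (R * x) + s * (R * x)
      distrib = solve-∀

    𝔼-attained : ∀ N f → ∃ λ A → (t + s) ^ N * f A ≤ 𝔼 N f
    𝔼-attained zero    f = [] , ≤-reflexive (+-identityʳ (f []))
    𝔼-attained (suc N) f with 𝔼-attained N (λ A → f (true ∷ A)) | 𝔼-attained N (λ A → f (false ∷ A))
    ... | A₁ , avg₁ | A₀ , avg₀ with f (true ∷ A₁) ≤? f (false ∷ A₀)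
    ...   | yes f₁≤f₀ = true ∷ A₁ , below-halves N f (f (true ∷ A₁)) avg₁ (≤-trans (*-monoʳ-≤ ((t + s) ^ N) f₁≤f₀) avg₀)
    ...   | no  f₁≰f₀ = false ∷ A₀ , below-halves N f (f (false ∷ A₀)) (≤-trans (*-monoʳ-≤ ((t + s) ^ N) (<⇒≤ (≰⇒> f₁≰f₀))) avg₁) avg₀

    𝔼-agreesOn : ∀ N b (e : Subset N) →
      𝔼 N (λ A → 𝟙 (agreesOn b e A)) * (t + s) ^ ∣ e ∣ ≡ weight b ^ ∣ e ∣ * (t + s) ^ N
    𝔼-agreesOn zero    b []          = refl
    𝔼-agreesOn (suc N) b (false ∷ e) = begin
      (t * X + s * X) * Y                      ≡⟨ distrib t s X Y ⟩
      (t + s) * (X * Y)                        ≡⟨ cong ((t + s) *_) (𝔼-agreesOn N b e) ⟩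
      (t + s) * (weight b ^ ∣ e ∣ * (t + s) ^ N) ≡⟨ regroup (t + s) (weight b ^ ∣ e ∣) ((t + s) ^ N) ⟩
      weight b ^ ∣ e ∣ * ((t + s) * (t + s) ^ N) ∎
      where
      open ≡-Reasoning
      X = 𝔼 N (λ A → 𝟙 (agreesOn b e A))
      Y = (t + s) ^ ∣ e ∣
      distrib : ∀ t s X Y → (t * X + s * X) * Y ≡ (t + s) * (X * Y)
      distrib = solve-∀
      regroup : ∀ r a b → r * (a * b) ≡ a * (r * b)
      regroup = solve-∀
    𝔼-agreesOn (suc N) b (true ∷ e) = begin
      𝔼 (suc N) (λ A → 𝟙 (agreesOn b (true ∷ e) A)) * ((t + s) * Y)
        ≡⟨ cong (_* ((t + s) * Y)) (head-inside b) ⟩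
      weight b * X * ((t + s) * Y)             ≡⟨ regroup (weight b) (t + s) X Y ⟩
      weight b * (t + s) * (X * Y)             ≡⟨ cong (weight b * (t + s) *_) (𝔼-agreesOn N b e) ⟩
      weight b * (t + s) * (weight b ^ ∣ e ∣ * (t + s) ^ N)
        ≡⟨ regroup (weight b) (weight b ^ ∣ e ∣) (t + s) ((t + s) ^ N) ⟩
      weight b * weight b ^ ∣ e ∣ * ((t + s) * (t + s) ^ N) ∎
      where
      open ≡-Reasoning
      X = 𝔼 N (λ A → 𝟙 (agreesOn b e A))
      Y = (t + s) ^ ∣ e ∣
      regroup : ∀ a b c d → a * c * (b * d) ≡ a * b * (c * d)
      regroup = solve-∀
      -- only the half of the sum where the first vertex has value b survives
      head-inside : ∀ b → 𝔼 (suc N) (λ A → 𝟙 (agreesOn b (true ∷ e) A)) ≡ weight b * 𝔼 N (λ A → 𝟙 (agreesOn b e A))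
      head-inside true  = vanish-right _
        where
        vanish-right : ∀ x → t * x + s * 𝔼 N (λ _ → 0) ≡ t * x
        vanish-right x rewrite 𝔼-0 N = trans (cong (t * x +_) (*-zeroʳ s)) (+-identityʳ (t * x))
      head-inside false = vanish-left _
        where
        vanish-left : ∀ x → t * 𝔼 N (λ _ → 0) + s * x ≡ s * x
        vanish-left x rewrite 𝔼-0 N | *-zeroʳ t = refl

    𝔼-edgeCost : ∀ N K (e : Subset N) n → ∣ e ∣ ≡ n →
      𝔼 N (λ A → edgeCost K A e) * (t + s) ^ n ≡ (s ^ n + K * t ^ n) * (t + s) ^ N
    𝔼-edgeCost N K e n refl = begin
      𝔼 N (λ A → edgeCost K A e) * R               ≡⟨ cong (_* R) (trans (𝔼-+ N _ _) (cong (Miss +_) (𝔼-* N K _))) ⟩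
      (Miss + K * Inside) * R                      ≡⟨ distrib Miss Inside K R ⟩
      Miss * R + K * (Inside * R)                  ≡⟨ cong₂ (λ x y → x + K * y) (𝔼-agreesOn N false e) (𝔼-agreesOn N true e) ⟩
      s ^ n * (t + s) ^ N + K * (t ^ n * (t + s) ^ N) ≡⟨ collect (s ^ n) (t ^ n) K ((t + s) ^ N) ⟩
      (s ^ n + K * t ^ n) * (t + s) ^ N ∎
      where
      open ≡-Reasoning
      R = (t + s) ^ ∣ e ∣
      Miss = 𝔼 N (λ A → 𝟙 (agreesOn false e A))
      Inside = 𝔼 N (λ A → 𝟙 (agreesOn true e A))
      distrib : ∀ a b K R → (a + K * b) * R ≡ a * R + K * (b * R)
      distrib = solve-∀
      collect : ∀ a b K T → a * T + K * (b * T) ≡ (a + K * b) * T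
      collect = solve-∀

    first-moment : ∀ {N} (E : List (Subset N)) n K .{{_ : NonZero (t + s)}} → All (λ e → ∣ e ∣ ≡ n) E →
      ∃ λ A → potential K E A * (t + s) ^ n ≤ length E * (s ^ n + K * t ^ n)
    first-moment {N} E n K uniform with 𝔼-attained N (potential K E)
    ... | A , below-average = A , *-cancelˡ-≤ T {{m^n≢0 (t + s) N}} (begin
      T * (potential K E A * R)                       ≡⟨ *-assoc T _ R ⟨
      T * potential K E A * R                         ≤⟨ *-monoˡ-≤ R below-average ⟩
      𝔼 N (potential K E) * R                         ≡⟨ cong (_* R) (𝔼-sumOver N E (λ e A → edgeCost K A e)) ⟩
      sumOver E (λ e → 𝔼 N (λ A → edgeCost K A e)) * R ≡⟨ sumOver-*ʳ E _ R ⟨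
      sumOver E (λ e → 𝔼 N (λ A → edgeCost K A e) * R) ≡⟨ sumOver-cong (All.map (λ {e} ∣e∣≡n → 𝔼-edgeCost N K e n ∣e∣≡n) uniform) ⟩
      sumOver E (λ _ → Q * T)                          ≡⟨ sumOver-const E (Q * T) ⟩
      length E * (Q * T)                               ≡⟨ regroup (length E) Q T ⟩
      T * (length E * Q) ∎)
      where
      open ≤-Reasoning
      T = (t + s) ^ N
      R = (t + s) ^ n
      Q = s ^ n + K * t ^ n
      regroup : ∀ m Q T → m * (Q * T) ≡ T * (m * Q)
      regroup = solve-∀

  -- Cost of an edge f after deleting the vertex u from A, where w ≠ u stays in A:
  -- unchanged if u ∉ f; zero if u, w ∈ f (f meets A but is not inside it);
  -- at most 1 if u ∈ f and w ∉ f.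
  cost-after-deletion : ∀ {N} K (A f : Subset N) u w → u ≢ w → lookup A w ≡ true →
    edgeCost K (A [ u ]≔ false) f ≤ 𝟙 (not (lookup f u)) * edgeCost K A f + 𝟙 (lookup f u ∧ not (lookup f w))
  cost-after-deletion K A f u w u≢w Aw with lookup f u in fu
  ... | false rewrite agreesOn-update false f A u false fu | agreesOn-update true f A u false fu =
    ≤-reflexive (sym (trans (+-identityʳ _) (*-identityˡ _)))
  ... | true rewrite agreesOn-conflict true f (A [ u ]≔ false) u fu (lookup∘updateAt u A) | *-zeroʳ K
                   | +-identityʳ (𝟙 (agreesOn false f (A [ u ]≔ false))) with lookup f w in fw
  ...   | true  rewrite agreesOn-conflict false f (A [ u ]≔ false) w fw
                          (trans (lookup∘updateAt′ w u (λ w≡u → u≢w (sym w≡u)) A) Aw) = z≤n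
  ...   | false = 𝟙≤1 _

  module Deletion {N} (E : List (Subset N)) (K : ℕ) (degree≤ : ∀ u → degree E u ≤ suc K) where

    -- If e ∈ E lies inside A and u ≠ w are two of its vertices, deleting u
    -- does not increase the potential: at most degree(u) - 1 ≤ K edges can
    -- start missing A, while e alone stops paying the penalty K.
    potential-after-deletion : ∀ A {e} u w → e ∈ E → agreesOn true e A ≡ true → u ≢ w →
      lookup e u ≡ true → lookup e w ≡ true → potential K E (A [ u ]≔ false) ≤ potential K E A
    potential-after-deletion A {e} u w e∈E e⊆A u≢w eu ew = begin
      sumOver E (edgeCost K (A [ u ]≔ false)) ≤⟨ sumOver-mono E (λ f → cost-after-deletion K A f u w u≢w Aw) ⟩
      sumOver E (λ f → off-u f + u-not-w f)   ≡⟨ sumOver-+ E off-u u-not-w ⟩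
      sumOver E off-u + sumOver E u-not-w     ≤⟨ +-monoʳ-≤ (sumOver E off-u) (≤-trans few-new-misses penalty≤on-u) ⟩
      sumOver E off-u + sumOver E on-u        ≡⟨ sumOver-+ E off-u on-u ⟨
      sumOver E (λ f → off-u f + on-u f)      ≡⟨ sumOver-cong (All.universal split-cost E) ⟩
      sumOver E (edgeCost K A) ∎
      where
      open ≤-Reasoning
      Aw : lookup A w ≡ true
      Aw = agreesOn-lookup true e A w e⊆A ew
      off-u on-u u-not-w u-and-w : Subset N → ℕ
      off-u   f = 𝟙 (not (lookup f u)) * edgeCost K A f
      on-u    f = 𝟙 (lookup f u) * edgeCost K A f
      u-not-w f = 𝟙 (lookup f u ∧ not (lookup f w))
      u-and-w f = 𝟙 (lookup f u ∧ lookup f w)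
      split-cost : ∀ f → off-u f + on-u f ≡ edgeCost K A f
      split-cost f with lookup f u
      ... | true  = +-identityʳ _
      ... | false = trans (+-identityʳ _) (+-identityʳ _)
      split-degree : ∀ f → u-not-w f + u-and-w f ≡ 𝟙 (lookup f u)
      split-degree f with lookup f u | lookup f w
      ... | true  | true  = refl
      ... | true  | false = refl
      ... | false | _     = refl
      -- e itself is an edge through both u and w
      e-counted : 1 ≤ sumOver E u-and-w
      e-counted = subst (_≤ sumOver E u-and-w) (cong₂ (λ x y → 𝟙 (x ∧ y)) eu ew) (term≤sumOver u-and-w e∈E)
      few-new-misses : sumOver E u-not-w ≤ K
      few-new-misses = ≤-pred (begin
        suc (sumOver E u-not-w)                  ≡⟨ +-comm 1 _ ⟩
        sumOver E u-not-w + 1                    ≤⟨ +-monoʳ-≤ (sumOver E u-not-w) e-counted ⟩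
        sumOver E u-not-w + sumOver E u-and-w    ≡⟨ sumOver-+ E u-not-w u-and-w ⟨
        sumOver E (λ f → u-not-w f + u-and-w f)  ≡⟨ sumOver-cong (All.universal split-degree E) ⟩
        degree E u                               ≤⟨ degree≤ u ⟩
        suc K ∎)
      -- e pays the penalty K and passes through u
      penalty≤on-u : K ≤ sumOver E on-u
      penalty≤on-u = ≤-trans (subst (K ≤_) (sym e-cost) (m≤n+m K _)) (term≤sumOver on-u e∈E)
        where
        e-cost : on-u e ≡ 𝟙 (agreesOn false e A) + K
        e-cost rewrite eu | e⊆A | *-identityʳ K = +-identityʳ _

    alteration : All (λ e → 2 ≤ ∣ e ∣) E → ∀ k A → ∣ A ∣ ≡ k →
      ∃ λ I → All (λ e → agreesOn true e I ≡ false) E × potential K E I ≤ potential K E A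
    alteration large k A ∣A∣≡k with inside-edge? E A
    ... | inj₂ none-inside = A , none-inside , ≤-refl
    ... | inj₁ (e , e∈E , e-inside) with two-elements e (All.lookup large e∈E)
    ...   | u , w , u≢w , eu , ew with k | trans (∣remove∣ A u (agreesOn-lookup true e A u e-inside eu)) ∣A∣≡k
    ...     | suc k′ | ∣A′∣+1≡k with alteration large k′ (A [ u ]≔ false) (suc-injective ∣A′∣+1≡k)
    ...       | I , independent , I≤A′ = I , independent , ≤-trans I≤A′ (potential-after-deletion A u w e∈E e-inside u≢w eu ew)

  potential-edge-free : ∀ {N} K (E : List (Subset N)) I → All (λ e → agreesOn true e I ≡ false) E →
    potential K E I ≡ missing E I
  potential-edge-free K E I none-inside = sumOver-cong (All.map (λ {e} → no-penalty {e}) none-inside)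
    where
    no-penalty : ∀ {e} → agreesOn true e I ≡ false → edgeCost K I e ≡ 𝟙 (agreesOn false e I)
    no-penalty {e} e-not-inside rewrite e-not-inside | *-zeroʳ K = +-identityʳ _

  edge-free-set : ∀ {N} (E : List (Subset N)) n K t s .{{_ : NonZero (t + s)}} → 2 ≤ n →
    All (λ e → ∣ e ∣ ≡ n) E → (∀ u → degree E u ≤ suc K) →
    ∃ λ I → All (λ e → agreesOn true e I ≡ false) E × missing E I * (t + s) ^ n ≤ length E * (s ^ n + K * t ^ n)
  edge-free-set E n K t s 2≤n uniform degree≤ with SubsetAverage.first-moment t s E n K uniform
  ... | A , A-small
    with Deletion.alteration E K degree≤ (All.map (λ ∣e∣≡n → subst (2 ≤_) (sym ∣e∣≡n) 2≤n) uniform) ∣ A ∣ A refl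
  ...   | I , none-inside , I≤A = I , none-inside , (begin
    missing E I * (t + s) ^ n       ≡⟨ cong (_* (t + s) ^ n) (potential-edge-free K E I none-inside) ⟨
    potential K E I * (t + s) ^ n   ≤⟨ *-monoˡ-≤ ((t + s) ^ n) I≤A ⟩
    potential K E A * (t + s) ^ n   ≤⟨ A-small ⟩
    length E * (s ^ n + K * t ^ n) ∎)
    where open ≤-Reasoning

module Fractions where

  open import Data.Nat as ℕ using (ℕ; zero; suc; _^_)
  import Data.Nat.Properties as ℕ
  open import Data.Nat.Coprimality using (Coprime)
  open import Data.Nat.Divisibility using (∣1⇒≡1)
  open import Data.Nat.GCD using (gcd[m,n]∣m)
  open import Data.Integer as ℤ using (+_)
  import Data.Integer.Properties as ℤ
  open import Data.Integer.GCD using () renaming (gcd to gcdℤ)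
  open import Data.Rational using (ℚ; mkℚ; _≤_; _*_; _/_; *≤*; ↥_; ↧_; toℚᵘ)
  open import Data.Rational.Properties using (toℚᵘ-homo-*; toℚᵘ-fromℚᵘ; toℚᵘ-mono-≤; toℚᵘ-cancel-≤; ↥-/; ↧-/)
  open import Data.Rational.Unnormalised as ℚᵘ using (ℚᵘ; mkℚᵘ) renaming (_≤_ to _≤ᵘ_; _*_ to _*ᵘ_; _≃_ to _≃ᵘ_)
  import Data.Rational.Unnormalised.Properties as ℚᵘ
  open import Relation.Binary.PropositionalEquality
  open import Function using (id)

  -- A non-negative rational c = a/(d+1) in normal form.  Comparisons of c·y
  -- with natural numbers reduce to inequalities between natural numbers.
  module NonNegativeFraction (a d : ℕ) .(cop : Coprime a (suc d)) where

    c : ℚ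
    c = mkℚ (+ a) d cop

    c·ᵘ : ℕ → ℚᵘ
    c·ᵘ y = mkℚᵘ (+ a) d *ᵘ mkℚᵘ (+ y) 0

    toℚᵘ-ℕ : ∀ x → toℚᵘ (ℕtoℚ x) ≃ᵘ mkℚᵘ (+ x) 0
    toℚᵘ-ℕ x = toℚᵘ-fromℚᵘ (mkℚᵘ (+ x) 0)

    toℚᵘ-c· : ∀ y → toℚᵘ (c * ℕtoℚ y) ≃ᵘ c·ᵘ y
    toℚᵘ-c· y = ℚᵘ.≃-trans (toℚᵘ-homo-* c (ℕtoℚ y)) (ℚᵘ.*-congˡ {mkℚᵘ (+ a) d} (toℚᵘ-ℕ y))

    cross-multiplied : ∀ x y → (+ x ℤ.* + (suc d ℕ.* 1) ℤ.≤ (+ a ℤ.* + y) ℤ.* + 1) ≡ (+ (x ℕ.* suc d) ℤ.≤ + (a ℕ.* y))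
    cross-multiplied x y = cong₂ ℤ._≤_
      (trans (sym (ℤ.pos-* x (suc d ℕ.* 1))) (cong (λ k → + (x ℕ.* k)) (ℕ.*-identityʳ (suc d))))
      (trans (ℤ.*-identityʳ (+ a ℤ.* + y)) (sym (ℤ.pos-* a y)))

    ≤c·⇒ : ∀ x y → ℕtoℚ x ≤ c * ℕtoℚ y → x ℕ.* suc d ℕ.≤ a ℕ.* y
    ≤c·⇒ x y x≤cy with ℚᵘ.≤-respʳ-≃ (toℚᵘ-c· y) (ℚᵘ.≤-respˡ-≃ (toℚᵘ-ℕ x) (toℚᵘ-mono-≤ x≤cy))
    ... | ℚᵘ.*≤* cross = ℤ.drop‿+≤+ (subst id (cross-multiplied x y) cross)

    ⇒≤c· : ∀ x y → x ℕ.* suc d ℕ.≤ a ℕ.* y → ℕtoℚ x ≤ c * ℕtoℚ y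
    ⇒≤c· x y xb≤ay = toℚᵘ-cancel-≤ (ℚᵘ.≤-respʳ-≃ (ℚᵘ.≃-sym (toℚᵘ-c· y)) (ℚᵘ.≤-respˡ-≃ (ℚᵘ.≃-sym (toℚᵘ-ℕ x))
      (ℚᵘ.*≤* (subst id (sym (cross-multiplied x y)) (ℤ.+≤+ xb≤ay)))))

    ≤unit-fraction⇒ : ∀ M .{{_ : ℕ.NonZero M}} → c ≤ + 1 / M → a ℕ.* M ℕ.≤ suc d
    ≤unit-fraction⇒ M (*≤* cross) = ℤ.drop‿+≤+ (subst₂ ℤ._≤_
      (trans (cong (+ a ℤ.*_) denominator) (sym (ℤ.pos-* a M)))
      (trans (cong (ℤ._* + suc d) numerator) (ℤ.*-identityˡ (+ suc d))) cross)
      where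
      gcd[1,M]≡1 : gcdℤ (+ 1) (+ M) ≡ + 1
      gcd[1,M]≡1 = cong +_ (∣1⇒≡1 (gcd[m,n]∣m 1 M))
      numerator : ↥ (+ 1 / M) ≡ + 1
      numerator = trans (sym (ℤ.*-identityʳ _)) (trans (cong (↥ (+ 1 / M) ℤ.*_) (sym gcd[1,M]≡1)) (↥-/ (+ 1) M))
      denominator : ↧ (+ 1 / M) ≡ + M
      denominator = trans (sym (ℤ.*-identityʳ _)) (trans (cong (↧ (+ 1 / M) ℤ.*_) (sym gcd[1,M]≡1)) (↧-/ (+ 1) M))

    -- c ≤ n^(-n) means a·n^n ≤ d+1 (also for n = 0, where inv-nⁿ 0 = 1 = 0^0).
    ≤inv-nⁿ⇒ : ∀ n → c ≤ inv-nⁿ n → a ℕ.* n ^ n ℕ.≤ suc d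
    ≤inv-nⁿ⇒ zero    = ≤unit-fraction⇒ 1
    ≤inv-nⁿ⇒ (suc k) = ≤unit-fraction⇒ (suc k ^ suc k) {{ℕ.m^n≢0 (suc k) (suc k)}}

module Hypergraphs where

  open Arithmetic
  open Subsets
  open AlterationMethod
  open import Data.Nat
  open import Data.Nat.Properties
  open import Data.Nat.Tactic.RingSolver using (solve-∀)
  open import Data.Bool using (Bool; true; false)
  open import Data.Bool.Properties using () renaming (_≟_ to _≟ᵇ_)
  open import Data.Fin.Subset using (Subset; ∣_∣; _⊆_; _∩_; ⊥; ⁅_⁆)
  open import Data.Fin.Subset.Properties using (p⊆q⇒∣p∣≤∣q∣; ∣⊥∣≡0; ∣⁅x⁆∣≡1)
  open import Data.Vec using (lookup)
  open import Data.Vec.Properties using (≡-dec)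
  open import Data.List using (List; []; _∷_; length; filter)
  open import Data.List.Relation.Unary.All using (All)
  import Data.List.Relation.Unary.All as All
  open import Data.Product using (Σ; _×_; _,_)
  open import Data.Sum using (inj₂)
  open import Relation.Nullary using (¬_; does; yes; no)
  open import Relation.Unary using (Decidable)
  open import Relation.Binary.PropositionalEquality

  length-filter : ∀ {A : Set} {P : A → Set} (P? : Decidable P) xs →
    length (filter P? xs) ≡ sumOver xs (λ x → 𝟙 (does (P? x)))
  length-filter P? []       = refl
  length-filter P? (x ∷ xs) with does (P? x)
  ... | true  = cong suc (length-filter P? xs)
  ... | false = length-filter P? xs

  indicator-sum≤length : ∀ {A : Set} (xs : List A) (p : A → Bool) → sumOver xs (λ x → 𝟙 (p x)) ≤ length xs
  indicator-sum≤length xs p = ≤-trans (sumOver-mono xs (λ x → 𝟙≤1 (p x)))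
                                      (≤-reflexive (trans (sumOver-const xs 1) (*-identityʳ (length xs))))

  numEdgesMinus≡missing : ∀ {nV} (H : Hypergraph nV) I → numEdgesMinus H I ≡ missing (edges H) I
  numEdgesMinus≡missing H I = trans (length-filter (λ e → ≡-dec _≟ᵇ_ (e ∩ I) ⊥) (edges H))
    (sumOver-cong (All.universal (λ e → cong 𝟙 (disjoint?≡agreesOn e I)) (edges H)))

  edge-free⇒independent : ∀ {nV} (H : Hypergraph nV) I → All (λ e → agreesOn true e I ≡ false) (edges H) →
    Independent H I
  edge-free⇒independent H I = All.map not-inside
    where
    not-inside : ∀ {e} → agreesOn true e I ≡ false → ¬ (e ⊆ I)
    not-inside e-not-inside e⊆I with trans (sym (⊆⇒agreesOn e⊆I)) e-not-inside
    ... | ()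

  small⇒independent : ∀ {nV} (H : Hypergraph nV) n I → Uniform n H → ∣ I ∣ < n → Independent H I
  small⇒independent H n I uniform ∣I∣<n = All.map too-large uniform
    where
    too-large : ∀ {e} → ∣ e ∣ ≡ n → ¬ (e ⊆ I)
    too-large ∣e∣≡n e⊆I = <-irrefl refl (≤-trans ∣I∣<n (≤-trans (≤-reflexive (sym ∣e∣≡n)) (p⊆q⇒∣p∣≤∣q∣ e⊆I)))

  missing-⁅⁆+degree : ∀ {N} (E : List (Subset N)) u → missing E ⁅ u ⁆ + degree E u ≡ length E
  missing-⁅⁆+degree E u = begin
    missing E ⁅ u ⁆ + degree E u                                      ≡⟨ sumOver-+ E _ _ ⟨
    sumOver E (λ f → 𝟙 (agreesOn false f ⁅ u ⁆) + 𝟙 (lookup f u)) ≡⟨ sumOver-cong (All.universal one-of-two E) ⟩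
    sumOver E (λ _ → 1)                                                ≡⟨ sumOver-const E 1 ⟩
    length E * 1                                                       ≡⟨ *-identityʳ (length E) ⟩
    length E ∎
    where
    open ≡-Reasoning
    one-of-two : ∀ f → 𝟙 (agreesOn false f ⁅ u ⁆) + 𝟙 (lookup f u) ≡ 1
    one-of-two f rewrite agreesOn-⁅⁆ f u with lookup f u
    ... | true  = refl
    ... | false = refl

  -- Let Δ be the maximum
  -- degree.  If deleting the edges through a vertex u of degree Δ already
  -- leaves at most (a/b)(s+1)^n edges, the star I = {u} works.  Otherwise Δ is
  -- so small that the random set of density 2/(s+2), after alteration, works.
  module LargeR {nV} (H : Hypergraph nV) (n s a b : ℕ) .{{_ : NonZero b}}
                (2≤n : 2 ≤ n) (uniform : Uniform n H) (edges≤ : numEdges H * b ≤ a * (2 + s) ^ n) where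

    private
      E = edges H
      m = length E

    bounded-degree-case : ∀ K → (∀ u → degree E u ≤ suc K) → s ^ n + K * 2 ^ n ≤ suc s ^ n →
      Σ (Subset nV) λ I → Independent H I × numEdgesMinus H I * b ≤ a * suc s ^ n
    bounded-degree-case K degree≤ increment with edge-free-set E n K 2 s 2≤n uniform degree≤
    ... | I , none-inside , few-missing = I , edge-free⇒independent H I none-inside ,
      subst (λ x → x * b ≤ a * suc s ^ n) (sym (numEdgesMinus≡missing H I))
        (ratio-transfer (missing E I) m a b (s ^ n + K * 2 ^ n) ((2 + s) ^ n) (suc s ^ n) {{m^n≢0 (2 + s) n}}
          few-missing edges≤ increment)

    star-case : ∀ u → (m ∸ degree E u) * b ≤ a * suc s ^ n →
      Σ (Subset nV) λ I → Independent H I × numEdgesMinus H I * b ≤ a * suc s ^ n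
    star-case u star-small = ⁅ u ⁆ , small⇒independent H n ⁅ u ⁆ uniform (subst (_< n) (sym (∣⁅x⁆∣≡1 u)) 2≤n) ,
      subst (λ x → x * b ≤ a * suc s ^ n) (sym (trans (numEdgesMinus≡missing H ⁅ u ⁆) missing≡m∸degree)) star-small
      where
      missing≡m∸degree : missing E ⁅ u ⁆ ≡ m ∸ degree E u
      missing≡m∸degree = trans (sym (m+n∸n≡m _ (degree E u))) (cong (_∸ degree E u) (missing-⁅⁆+degree E u))

    -- If the star at a vertex of degree K+1 fails, then (K+1)·n^n + (s+1)^n < (s+2)^n,
    -- which by increment-transfer is the increment condition for K.
    failed-star : ∀ K u → degree E u ≡ suc K → a * n ^ n ≤ b → ¬ ((m ∸ degree E u) * b ≤ a * suc s ^ n) →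
      s ^ n + K * 2 ^ n ≤ suc s ^ n
    failed-star K u deg≡ aNⁿ≤b star-fails rewrite deg≡ = increment-transfer n s K 2≤n (<⇒≤ (*-cancelˡ-< a _ _ (begin-strict
      a * (suc K * n ^ n + P)        ≡⟨ distrib a (suc K) (n ^ n) P ⟩
      suc K * (a * n ^ n) + a * P    ≤⟨ +-monoˡ-≤ (a * P) (*-monoʳ-≤ (suc K) aNⁿ≤b) ⟩
      suc K * b + a * P              <⟨ +-monoʳ-< (suc K * b) (≰⇒> star-fails) ⟩
      suc K * b + (m ∸ suc K) * b    ≡⟨ *-distribʳ-+ b (suc K) (m ∸ suc K) ⟨
      (suc K + (m ∸ suc K)) * b      ≡⟨ cong (_* b) (m+[n∸m]≡n K+1≤m) ⟩
      m * b                          ≤⟨ edges≤ ⟩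
      a * (2 + s) ^ n ∎)))
      where
      open ≤-Reasoning
      P = suc s ^ n
      K+1≤m : suc K ≤ m
      K+1≤m = subst (_≤ m) deg≡ (indicator-sum≤length E (λ f → lookup f u))
      distrib : ∀ a D N P → a * (D * N + P) ≡ D * (a * N) + a * P
      distrib = solve-∀

    theorem : a * n ^ n ≤ b → Σ (Subset nV) λ I → Independent H I × numEdgesMinus H I * b ≤ a * suc s ^ n
    theorem aNⁿ≤b with bounded-attained (degree E)
    ... | zero  , degree≤0 , _ = bounded-degree-case 0 (λ u → m≤n⇒m≤1+n (degree≤0 u))
                                   (≤-trans (≤-reflexive (+-identityʳ (s ^ n))) (^-monoˡ-≤ n (n≤1+n s)))
    ... | suc K , degree≤ , inj₂ (u , deg≡) with (m ∸ degree E u) * b ≤? a * suc s ^ n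
    ...   | yes star-small = star-case u star-small
    ...   | no  star-fails = bounded-degree-case K degree≤ (failed-star K u deg≡ aNⁿ≤b star-fails)

  edgeless-case : ∀ {nV} (H : Hypergraph nV) n a b .{{_ : NonZero b}} → 2 ≤ n → Uniform n H →
    a * n ^ n ≤ b → numEdges H * b ≤ a * 1 ^ n →
    Σ (Subset nV) λ I → Independent H I × numEdgesMinus H I * b ≤ a * 0 ^ n
  edgeless-case {nV} H n a b 2≤n uniform aNⁿ≤b edges≤ =
    ⊥ , small⇒independent H n ⊥ uniform (subst (_< n) (sym (∣⊥∣≡0 nV)) (≤-trans (s≤s z≤n) 2≤n)) ,
    subst (λ x → x * b ≤ a * 0 ^ n) (sym nothing-left) z≤n
    where
    no-edges : numEdges H ≡ 0
    no-edges = vanishing (numEdges H) a b (n ^ n) (≤-trans 2≤n (n≤nⁿ n (≤-trans (s≤s z≤n) 2≤n)))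
                 (subst (λ x → numEdges H * b ≤ x) (trans (cong (a *_) (^-zeroˡ n)) (*-identityʳ a)) edges≤) aNⁿ≤b
      where
      n≤nⁿ : ∀ n → 1 ≤ n → n ≤ n ^ n
      n≤nⁿ (suc k) _ = ≤-trans (≤-reflexive (sym (*-identityʳ (suc k)))) (*-monoʳ-≤ (suc k) (m^n>0 (suc k) k))
    nothing-left : numEdgesMinus H ⊥ ≡ 0
    nothing-left = n≤0⇒n≡0 (≤-trans (≤-reflexive (numEdgesMinus≡missing H ⊥))
                     (≤-trans (indicator-sum≤length (edges H) (λ e → agreesOn false e ⊥)) (≤-reflexive no-edges)))

  corollary2ℕ : ∀ {nV} (H : Hypergraph nV) n r a b .{{_ : NonZero b}} → 2 ≤ n → 1 ≤ r → Uniform n H →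
    a * n ^ n ≤ b → numEdges H * b ≤ a * r ^ n →
    Σ (Subset nV) λ I → Independent H I × numEdgesMinus H I * b ≤ a * (r ∸ 1) ^ n
  corollary2ℕ H n (suc zero)    a b 2≤n _ uniform aNⁿ≤b edges≤ = edgeless-case H n a b 2≤n uniform aNⁿ≤b edges≤
  corollary2ℕ H n (suc (suc s)) a b 2≤n _ uniform aNⁿ≤b edges≤ = LargeR.theorem H n s a b 2≤n uniform edges≤ aNⁿ≤b

open import Data.Nat using (ℕ; _≥_; _^_; _∸_; suc)
open import Data.Integer using (+_; -[1+_])
open import Data.Rational using (ℚ; mkℚ; _≤_; _<_; _*_; 0ℚ; *<*)
open import Data.Fin.Subset using (Subset)
open import Data.Product using (Σ; _×_; _,_)
open Fractions using (module NonNegativeFraction)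
open Hypergraphs using (corollary2ℕ)

corollary2 : (n r : ℕ) → n ≥ 2 → r ≥ 1 → (c : ℚ) → 0ℚ < c → c ≤ inv-nⁿ n →
    (nV : ℕ) (H : Hypergraph nV) → Uniform n H →
    ℕtoℚ (numEdges H) ≤ c * ℕtoℚ (r ^ n) →
    Σ (Subset nV) (λ I → Independent H I × (ℕtoℚ (numEdgesMinus H I) ≤ c * ℕtoℚ ((r ∸ 1) ^ n)))
corollary2 n r 2≤n 1≤r (mkℚ -[1+ _ ] _ _) (*<* ())
corollary2 n r 2≤n 1≤r (mkℚ (+ a) d cop) _ c≤n⁻ⁿ nV H uniform edges≤ =
  let I , independent , few-left = corollary2ℕ H n r a (suc d) 2≤n 1≤r uniform
                                     (≤inv-nⁿ⇒ n c≤n⁻ⁿ) (≤c·⇒ (numEdges H) (r ^ n) edges≤)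
  in I , independent , ⇒≤c· (numEdgesMinus H I) ((r ∸ 1) ^ n) few-left
  where open NonNegativeFraction a d cop
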